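{- Let $n\ge 4$ be even, $a,b$ odd with $0<a<b<n$, and $X=\mathcal{M}_O(n,a,b)$. Suppose $\gcd(b-a,n)=2$ and $a\neq n-b$ (so the edges within $V$ form an $n$-cycle). Then $\mathrm{Aut}(X)$ contains a subgroup $G$ acting regularly on $V(X)$ that preserves the partition of $E(X)$ into the $n$-cycle on $U$, the $n$-cycle on $V$, and the perfect matching $\{[u_i,v_i]\}$ (i.e. each element of $G$ maps each of these three parts onto one of the three parts) if and only if $(b-a)^2/2\equiv 2\pmod n$ and at least one of $a+(a-1)(a-b)/2\equiv 1\pmod n$ or $b+(b-1)(b-a)/2\equiv 1\pmod n$ holds.
   Context: $\mathcal{M}_O(n,a,b)$ has vertices $u_0,\dots,u_{n-1},v_0,\dots,v_{n-1}$ and edges $[u_i,u_{i+1}]$ and $[u_i,v_i]$ for all $i$, and $[v_i,v_{i+a}]$, $[v_i,v_{i+b}]$ for all even $i$, subscripts modulo $n$; $U=\{u_i\}$, $V=\{v_i\}$. -}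

module Defs where

open import Level using (Level)
open import Data.Nat as ℕ using (ℕ; NonZero; _%_)
open import Data.Nat.DivMod using (_mod_)
open import Data.Fin using (Fin; toℕ)
open import Data.Integer as ℤ using (ℤ; +_)
open import Data.Integer.Divisibility as ℤD using ()
open import Data.Product using (Σ; ∃; _×_)
open import Data.Sum using (_⊎_)
open import Function.Bundles using (_⇔_)
open import Relation.Binary.PropositionalEquality using (_≡_; _≗_)

_≡_[modℤ_] : ℤ → ℤ → ℕ → Set
x ≡ y [modℤ m ] = (+ m) ℤD.∣ (x ℤ.- y)

module Graph (n : ℕ) .{{_ : NonZero n}} (a b : ℕ) where

  _⊕_ : Fin n → ℕ → Fin n
  i ⊕ k = (toℕ i ℕ.+ k) mod n

  IsEvenIdx : Fin n → Set
  IsEvenIdx i = toℕ i % 2 ≡ 0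

  data Vert : Set where
    u : Fin n → Vert
    v : Fin n → Vert

  -- the three parts of the edge set, as symmetric relations on vertices
  -- (an undirected edge [x,y] is recorded in both orientations)
  data UEdge : Vert → Vert → Set where
    fwd : ∀ i → UEdge (u i) (u (i ⊕ 1))
    bwd : ∀ i → UEdge (u (i ⊕ 1)) (u i)

  data VEdge : Vert → Vert → Set where
    fwdA : ∀ i → IsEvenIdx i → VEdge (v i) (v (i ⊕ a))
    bwdA : ∀ i → IsEvenIdx i → VEdge (v (i ⊕ a)) (v i)
    fwdB : ∀ i → IsEvenIdx i → VEdge (v i) (v (i ⊕ b))
    bwdB : ∀ i → IsEvenIdx i → VEdge (v (i ⊕ b)) (v i)

  data MEdge : Vert → Vert → Set where
    fwd : ∀ i → MEdge (u i) (v i)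
    bwd : ∀ i → MEdge (v i) (u i)

  Adj : Vert → Vert → Set
  Adj x y = UEdge x y ⊎ VEdge x y ⊎ MEdge x y

  data Part : Set where
    partU partV partM : Part

  PartEdge : Part → Vert → Vert → Set
  PartEdge partU = UEdge
  PartEdge partV = VEdge
  PartEdge partM = MEdge

  -- g is a graph automorphism (bijectivity is provided by the group structure below)
  PreservesAdj : (Vert → Vert) → Set
  PreservesAdj g = ∀ x y → Adj x y ⇔ Adj (g x) (g y)

  PreservesPartition : (Vert → Vert) → Set
  PreservesPartition g = ∀ P → Σ Part λ Q → ∀ x y → PartEdge P x y ⇔ PartEdge Q (g x) (g y)

  record IsPermGroup (G : (Vert → Vert) → Set) : Set₁ where
    field
      has-id  : G (λ x → x)
      has-∘   : ∀ {f g} → G f → G g → G (λ x → f (g x))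
      has-inv : ∀ {f} → G f → Σ (Vert → Vert) λ h → G h × ((λ x → h (f x)) ≗ (λ x → x)) × ((λ x → f (h x)) ≗ (λ x → x))

  IsRegular : ((Vert → Vert) → Set) → Set
  IsRegular G = (∀ x y → Σ (Vert → Vert) λ g → G g × g x ≡ y)
              × (∀ {f g} → G f → G g → ∀ x → f x ≡ g x → f ≗ g)

  HasRegularPartitionPreservingSubgroup : Set₁
  HasRegularPartitionPreservingSubgroup =
    Σ ((Vert → Vert) → Set) λ G →
        IsPermGroup G
      × (∀ {g} → G g → PreservesAdj g)
      × (∀ {g} → G g → PreservesPartition g)
      × IsRegular G

-- Number the vertices by integers modulo n and read a partition-preserving automorphism as a
-- map on indices.  Such a map fixes the matching and either preserves or exchanges the two
-- cycles, and it is determined by the image of one vertex: following the U-cycle from a vertex,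
-- its image is forced along a path of the image part.  Write the odd numbers a, b as
-- P = 2π + 1, Q = 2κ + 1 in one of the two orders and put δ = κ − π, h = π + κ + 1,
-- K = h − δP.  An automorphism g with g(u₀) = v₀ must be u_x ↦ v_{σx}, v_x ↦ u_{σx}, where
-- σx = −δx for even x and σx = h − δx for odd x (P being the label of g(u₁)).  It sends the
-- V-edges v₀v_P, v₀v_Q to U-edges at u₀, so {σP, σQ} = {K, K − 2δ²} is {1, −1} modulo n; the
-- wrong order would give a + b ≡ 0.  Conversely, if 2δ² ≡ 2 and K ≡ 1 then σ is an involution
-- inducing such an automorphism; together with the rotations x ↦ x + s (s even) and the
-- reflections x ↦ s − x (s odd) it makes the group of all partition-preserving automorphisms
-- transitive, and by the rigidity above that group is regular.  Finally 2δ² = (b − a)²/2 and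
-- K = P + (P − 1)(P − Q)/2.
module Submission where

open import Defs
open import Data.Nat using (ℕ; NonZero; _≤_; _<_; _%_; _∸_)
open import Data.Nat.GCD using (gcd)
open import Data.Integer as ℤ using (ℤ; +_)
open import Data.Product using (_×_)
open import Data.Sum using (_⊎_)
open import Function.Bundles using (_⇔_)
open import Relation.Binary.PropositionalEquality using (_≡_; _≢_)

import Data.Nat as ℕ
import Data.Nat.Properties as ℕP
import Data.Nat.DivMod as ℕD
import Data.Nat.Divisibility as ℕ∣
open import Data.Integer using (_+_; _*_; _-_; -_)
import Data.Integer.Properties as ℤP
import Data.Integer.DivMod as ℤD
open import Data.Integer.Divisibility.Signed
open import Data.Integer.Tactic.RingSolver using (solve-∀)
open import Data.Fin using (Fin; toℕ; fromℕ<)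
import Data.Fin.Properties as FinP
open import Data.Product using (Σ; _,_; proj₁; proj₂)
open import Data.Product.Function.NonDependent.Propositional using (_×-⇔_)
open import Data.Sum using (inj₁; inj₂)
import Data.Sum as Sum
open import Data.Sum.Function.Propositional using (_⊎-⇔_)
open import Data.Empty using (⊥; ⊥-elim)
open import Function.Base using (_∘_)
open import Function.Bundles using (Equivalence; mk⇔)
import Function.Properties.Equivalence as ⇔
open import Relation.Nullary using (¬_)
open import Relation.Binary.Bundles using (Setoid)
open import Relation.Binary.Structures using (IsEquivalence)
open import Relation.Binary.Definitions using (tri<; tri≈; tri>)
import Relation.Binary.Reasoning.Setoid as SetoidReasoning
open import Relation.Binary.PropositionalEquality
  using (_≗_; refl; sym; trans; cong; cong₂; subst; subst₂; module ≡-Reasoning)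

pigeonhole : ∀ {X : Set} {R : X → Set} {c₁ c₂ : X} → (∀ {w} → R w → w ≡ c₁ ⊎ w ≡ c₂) →
             ∀ {y₁ y₂ y₃} → R y₁ → R y₂ → R y₃ → y₁ ≡ y₂ ⊎ y₁ ≡ y₃ ⊎ y₂ ≡ y₃
pigeonhole two r₁ r₂ r₃ with two r₁ | two r₂ | two r₃
... | inj₁ p | inj₁ q | _      = inj₁ (trans p (sym q))
... | inj₂ p | inj₂ q | _      = inj₁ (trans p (sym q))
... | inj₁ p | inj₂ _ | inj₁ r = inj₂ (inj₁ (trans p (sym r)))
... | inj₂ p | inj₁ _ | inj₂ r = inj₂ (inj₁ (trans p (sym r)))
... | inj₁ _ | inj₂ q | inj₂ r = inj₂ (inj₂ (trans q (sym r)))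
... | inj₂ _ | inj₁ q | inj₁ r = inj₂ (inj₂ (trans q (sym r)))

non-backtracking-walk≡path :
  ∀ {X : Set} (R : X → X → Set) (p y : ℕ → X) →
  (∀ k {w} → R (p (ℕ.suc k)) w → w ≡ p k ⊎ w ≡ p (ℕ.suc (ℕ.suc k))) →
  (∀ k → R (y (ℕ.suc k)) (y (ℕ.suc (ℕ.suc k)))) →
  (∀ k → y (ℕ.suc (ℕ.suc k)) ≢ y k) →
  y 0 ≡ p 0 → y 1 ≡ p 1 → ∀ k → y k ≡ p k
non-backtracking-walk≡path R p y path-neighbours walk no-return y₀ y₁ k = proj₁ (agrees k)
  where
  agrees : ∀ k → y k ≡ p k × y (ℕ.suc k) ≡ p (ℕ.suc k)
  agrees 0 = y₀ , y₁
  agrees (ℕ.suc k) with agrees k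
  ... | yk , yk+1 with path-neighbours k (subst (λ z → R z _) yk+1 (walk k))
  ...   | inj₁ back = ⊥-elim (no-return k (trans back (sym yk)))
  ...   | inj₂ next = yk+1 , next

module Congruence (m : ℕ) where

  infix 4 _≈_
  record _≈_ (x y : ℤ) : Set where
    constructor mk
    field difference : + m ∣ x - y
  open _≈_ public

  ≈-reflexive : ∀ {x y} → x ≡ y → x ≈ y
  ≈-reflexive {x} refl = mk (divides (+ 0) (ℤP.+-inverseʳ x))

  ≈-refl : ∀ {x} → x ≈ x
  ≈-refl = ≈-reflexive refl

  ≈-sym : ∀ {x y} → x ≈ y → y ≈ x
  ≈-sym {x} {y} (mk d) = mk (subst (+ m ∣_) (lemma x y) (∣m⇒∣-m d))
    where lemma : ∀ x y → - (x - y) ≡ y - x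
          lemma = solve-∀

  ≈-trans : ∀ {x y z} → x ≈ y → y ≈ z → x ≈ z
  ≈-trans {x} {y} {z} (mk d) (mk e) = mk (subst (+ m ∣_) (lemma x y z) (∣m∣n⇒∣m+n d e))
    where lemma : ∀ x y z → (x - y) + (y - z) ≡ x - z
          lemma = solve-∀

  ≈-isEquivalence : IsEquivalence _≈_
  ≈-isEquivalence = record { refl = ≈-refl ; sym = ≈-sym ; trans = ≈-trans }

  ≈-setoid : Setoid _ _
  ≈-setoid = record { isEquivalence = ≈-isEquivalence }

  module ≈-Reasoning = SetoidReasoning ≈-setoid

  ≈⇔≡[modℤ] : ∀ {x y} → x ≈ y ⇔ x ≡ y [modℤ m ]
  ≈⇔≡[modℤ] = mk⇔ (∣⇒∣ᵤ ∘ difference) (mk ∘ ∣ᵤ⇒∣)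

  +-cong : ∀ {x y z w} → x ≈ y → z ≈ w → x + z ≈ y + w
  +-cong {x} {y} {z} {w} (mk d) (mk e) = mk (subst (+ m ∣_) (lemma x y z w) (∣m∣n⇒∣m+n d e))
    where lemma : ∀ x y z w → (x - y) + (z - w) ≡ (x + z) - (y + w)
          lemma = solve-∀

  +-congʳ : ∀ c {x y} → x ≈ y → x + c ≈ y + c
  +-congʳ c p = +-cong p ≈-refl

  *-congˡ : ∀ k {x y} → x ≈ y → k * x ≈ k * y
  *-congˡ k {x} {y} (mk d) = mk (subst (+ m ∣_) (lemma k x y) (∣n⇒∣m*n k d))
    where lemma : ∀ k x y → k * (x - y) ≡ k * x - k * y
          lemma = solve-∀

  -‿cong : ∀ {x y} → x ≈ y → - x ≈ - y
  -‿cong {x} {y} p = subst₂ _≈_ (lemma x) (lemma y) (*-congˡ (- + 1) p)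
    where lemma : ∀ x → - + 1 * x ≡ - x
          lemma = solve-∀

  ≈⇒-≈0 : ∀ {x y} → x ≈ y → x - y ≈ + 0
  ≈⇒-≈0 {x} {y} (mk d) = mk (subst (+ m ∣_) (sym (ℤP.+-identityʳ (x - y))) d)

  private
    ∣-<⇒≡0 : ∀ {k} → .{{_ : NonZero m}} → m ℕ∣.∣ k → k < m → k ≡ 0
    ∣-<⇒≡0 {k} m∣k k<m = trans (sym (ℕD.m<n⇒m%n≡m k<m)) (ℕ∣.n∣m⇒m%n≡0 k m m∣k)

    residue-injective-≤ : ∀ {r s} → .{{_ : NonZero m}} → r ≤ s → s < m → + s ≈ + r → s ≡ r
    residue-injective-≤ {r} {s} r≤s s<m (mk m∣s-r) = ℕP.≤-antisym (ℕP.m∸n≡0⇒m≤n s∸r≡0) r≤s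
      where
      s-r≡s∸r : + s - + r ≡ + (s ∸ r)
      s-r≡s∸r = trans (ℤP.m-n≡m⊖n s r) (ℤP.⊖-≥ r≤s)
      s∸r≡0 : s ∸ r ≡ 0
      s∸r≡0 = ∣-<⇒≡0 (subst (m ℕ∣.∣_) (cong ℤ.∣_∣ s-r≡s∸r) (∣⇒∣ᵤ m∣s-r))
                     (ℕP.≤-<-trans (ℕP.m∸n≤m s r) s<m)

  residue-injective : ∀ {r s} → .{{_ : NonZero m}} → r < m → s < m → + r ≈ + s → r ≡ s
  residue-injective {r} {s} r<m s<m p with ℕP.≤-total r s
  ... | inj₁ r≤s = sym (residue-injective-≤ r≤s s<m (≈-sym p))
  ... | inj₂ s≤r = residue-injective-≤ s≤r r<m p

  %ℕ-≈ : ∀ x → .{{_ : NonZero m}} → + (x ℤ.%ℕ m) ≈ x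
  %ℕ-≈ x = mk (divides (- q) (begin
      + r - x                  ≡⟨ cong (_-_ (+ r)) (ℤD.a≡a%ℕn+[a/ℕn]*n x m) ⟩
      + r - (+ r + q * + m)    ≡⟨ lemma (+ r) q (+ m) ⟩
      - q * + m                ∎))
    where
    open ≡-Reasoning
    r : ℕ
    r = x ℤ.%ℕ m
    q : ℤ
    q = x ℤ./ℕ m
    lemma : ∀ r q m → r - (r + q * m) ≡ - q * m
    lemma = solve-∀

≈-weaken : ∀ {d m x y} → + d ∣ + m → Congruence._≈_ m x y → Congruence._≈_ d x y
≈-weaken d∣m (Congruence.mk m∣x-y) = Congruence.mk (∣-trans d∣m m∣x-y)

module Parity where

  open Congruence 2 public using () renaming (_≈_ to _≈₂_)
  open Congruence 2

  Even Odd : ℤ → Set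
  Even x = x ≈₂ + 0
  Odd x = x ≈₂ + 1

  even⇒¬odd : ∀ {x} → Even x → Odd x → ⊥
  even⇒¬odd e o = ℕP.0≢1+n (residue-injective (ℕ.s≤s ℕ.z≤n) ℕP.≤-refl (≈-trans (≈-sym e) o))

  %2≡0⇒even : ∀ x → x ℤ.%ℕ 2 ≡ 0 → Even x
  %2≡0⇒even x eq = ≈-trans (≈-sym (%ℕ-≈ x)) (≈-reflexive (cong +_ eq))

  %2≡1⇒odd : ∀ x → x ℤ.%ℕ 2 ≡ 1 → Odd x
  %2≡1⇒odd x eq = ≈-trans (≈-sym (%ℕ-≈ x)) (≈-reflexive (cong +_ eq))

  even⇒%2≡0 : ∀ {x} → Even x → x ℤ.%ℕ 2 ≡ 0
  even⇒%2≡0 {x} e = residue-injective (ℤD.n%ℕd<d x 2) (ℕ.s≤s ℕ.z≤n) (≈-trans (%ℕ-≈ x) e)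

  odd⇒%2≡1 : ∀ {x} → Odd x → x ℤ.%ℕ 2 ≡ 1
  odd⇒%2≡1 {x} o = residue-injective (ℤD.n%ℕd<d x 2) ℕP.≤-refl (≈-trans (%ℕ-≈ x) o)

  ≈₂⇒%2≡ : ∀ {x y} → x ≈₂ y → x ℤ.%ℕ 2 ≡ y ℤ.%ℕ 2
  ≈₂⇒%2≡ {x} {y} p = residue-injective (ℤD.n%ℕd<d x 2) (ℤD.n%ℕd<d y 2)
                                        (≈-trans (%ℕ-≈ x) (≈-trans p (≈-sym (%ℕ-≈ y))))

  even⊎odd : ∀ x → Even x ⊎ Odd x
  even⊎odd x with x ℤ.%ℕ 2 | ℤD.n%ℕd<d x 2 | %ℕ-≈ x
  ... | 0 | _ | p = inj₁ (≈-sym p)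
  ... | 1 | _ | p = inj₂ (≈-sym p)
  ... | ℕ.suc (ℕ.suc _) | ℕ.s≤s (ℕ.s≤s ()) | _

  odd⇒2k+1 : ∀ {x} → Odd x → Σ ℤ λ k → k * + 2 + + 1 ≡ x
  odd⇒2k+1 {x} (mk (divides k x-1≡2k)) = k , trans (cong (_+ + 1) (sym x-1≡2k)) (lemma x)
    where lemma : ∀ x → x - + 1 + + 1 ≡ x
          lemma = solve-∀

  odd-2k+1 : ∀ k → Odd (k * + 2 + + 1)
  odd-2k+1 k = mk (divides k (lemma k))
    where lemma : ∀ k → k * + 2 + + 1 - + 1 ≡ k * + 2
          lemma = solve-∀

  even-0 : Even (+ 0)
  even-0 = ≈-refl

  ≈₂-even : ∀ {x y} → x ≈₂ y → Even x → Even y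
  ≈₂-even p e = ≈-trans (≈-sym p) e

  ≈₂-odd : ∀ {x y} → x ≈₂ y → Odd x → Odd y
  ≈₂-odd p o = ≈-trans (≈-sym p) o

  even+even : ∀ {x y} → Even x → Even y → Even (x + y)
  even+even e e′ = +-cong e e′

  even+odd : ∀ {x y} → Even x → Odd y → Odd (x + y)
  even+odd e o = +-cong e o

  odd+even : ∀ {x y} → Odd x → Even y → Odd (x + y)
  odd+even o e = ≈-trans (+-cong o e) (≈-reflexive (ℤP.+-identityʳ (+ 1)))

  odd+odd : ∀ {x y} → Odd x → Odd y → Even (x + y)
  odd+odd o o′ = ≈-trans (+-cong o o′) (mk (divides (+ 1) refl))

  odd-odd : ∀ {x y} → Odd x → Odd y → Even (x - y)
  odd-odd o o′ = odd+odd o (≈-trans (-‿cong o′) (mk (divides (- + 1) refl)))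

  -even : ∀ {x} → Even x → Even (- x)
  -even e = -‿cong e

  even-*ˡ : ∀ k {x} → Even x → Even (k * x)
  even-*ˡ k e = ≈-trans (*-congˡ k e) (≈-reflexive (ℤP.*-zeroʳ k))

  odd-suc : ∀ {x} → Even x → Odd (x + + 1)
  odd-suc e = even+odd e ≈-refl

  odd-pred : ∀ {x} → Even x → Odd (x - + 1)
  odd-pred e = even+odd e (mk (divides (- + 1) refl))

  even-suc : ∀ {x} → Odd x → Even (x + + 1)
  even-suc o = odd+odd o ≈-refl

  even-pred : ∀ {x} → Odd x → Even (x - + 1)
  even-pred o = odd+odd o (mk (divides (- + 1) refl))

*2/2 : ∀ x → (x * + 2) ℤ./ + 2 ≡ x
*2/2 x = ℤP.*-cancelʳ-≡ _ _ (+ 2) (sym (begin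
    x * + 2                                          ≡⟨ ℤD.a≡a%n+[a/n]*n (x * + 2) (+ 2) ⟩
    + ((x * + 2) ℤ.% + 2) + (x * + 2) ℤ./ + 2 * + 2  ≡⟨ cong (λ r → + r + (x * + 2) ℤ./ + 2 * + 2) remainder≡0 ⟩
    + 0 + (x * + 2) ℤ./ + 2 * + 2                    ≡⟨ ℤP.+-identityˡ _ ⟩
    (x * + 2) ℤ./ + 2 * + 2                          ∎))
  where
  open ≡-Reasoning
  open Parity
  remainder≡0 : (x * + 2) ℤ.%ℕ 2 ≡ 0
  remainder≡0 = even⇒%2≡0 {x * + 2} (Congruence.mk (divides x (ℤP.+-identityʳ (x * + 2))))

module Residues (n : ℕ) .{{_ : NonZero n}} where

  open Congruence n

  fromℤ : ℤ → Fin n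
  fromℤ x = fromℕ< (ℤD.n%ℕd<d x n)

  toℤ : Fin n → ℤ
  toℤ i = + toℕ i

  toℤ-fromℤ : ∀ x → toℤ (fromℤ x) ≈ x
  toℤ-fromℤ x = subst (_≈ x) (cong +_ (sym (FinP.toℕ-fromℕ< (ℤD.n%ℕd<d x n)))) (%ℕ-≈ x)

  toℤ-injective : ∀ {i j} → toℤ i ≈ toℤ j → i ≡ j
  toℤ-injective {i} {j} p = FinP.toℕ-injective (residue-injective (FinP.toℕ<n i) (FinP.toℕ<n j) p)

  fromℤ-toℤ : ∀ i → fromℤ (toℤ i) ≡ i
  fromℤ-toℤ i = toℤ-injective (toℤ-fromℤ (toℤ i))

  fromℤ-cong : ∀ {x y} → x ≈ y → fromℤ x ≡ fromℤ y
  fromℤ-cong {x} {y} p = toℤ-injective (≈-trans (toℤ-fromℤ x) (≈-trans p (≈-sym (toℤ-fromℤ y))))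

  fromℤ-injective : ∀ {x y} → fromℤ x ≡ fromℤ y → x ≈ y
  fromℤ-injective {x} {y} eq =
    ≈-trans (≈-sym (toℤ-fromℤ x)) (≈-trans (≈-reflexive (cong toℤ eq)) (toℤ-fromℤ y))

module Edges (n : ℕ) .{{_ : NonZero n}} (n-even : n % 2 ≡ 0) (a b : ℕ) (a-odd : a % 2 ≡ 1) (b-odd : b % 2 ≡ 1) where

  open Graph n a b
  open Congruence n
  open Residues n
  open Parity

  A B : ℤ
  A = + a
  B = + b

  A-odd : Odd A
  A-odd = %2≡1⇒odd A a-odd

  B-odd : Odd B
  B-odd = %2≡1⇒odd B b-odd

  Labelling : ℤ → ℤ → Set
  Labelling P Q = P ≡ A × Q ≡ B ⊎ P ≡ B × Q ≡ A

  ≈⇒≈₂ : ∀ {x y} → x ≈ y → x ≈₂ y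
  ≈⇒≈₂ = ≈-weaken (∣ᵤ⇒∣ (ℕ∣.m%n≡0⇒n∣m n 2 n-even))

  ≈-even : ∀ {x y} → x ≈ y → Even x → Even y
  ≈-even p = ≈₂-even (≈⇒≈₂ p)

  ≈-odd : ∀ {x y} → x ≈ y → Odd x → Odd y
  ≈-odd p = ≈₂-odd (≈⇒≈₂ p)

  u[_] v[_] : ℤ → Vert
  u[ x ] = u (fromℤ x)
  v[ x ] = v (fromℤ x)

  u-toℤ : ∀ i → u i ≡ u[ toℤ i ]
  u-toℤ i = cong u (sym (fromℤ-toℤ i))

  v-toℤ : ∀ i → v i ≡ v[ toℤ i ]
  v-toℤ i = cong v (sym (fromℤ-toℤ i))

  u[]-cong : ∀ {x y} → x ≈ y → u[ x ] ≡ u[ y ]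
  u[]-cong p = cong u (fromℤ-cong p)

  v[]-cong : ∀ {x y} → x ≈ y → v[ x ] ≡ v[ y ]
  v[]-cong p = cong v (fromℤ-cong p)

  u-injective : ∀ {i j} → u i ≡ u j → i ≡ j
  u-injective refl = refl

  v-injective : ∀ {i j} → v i ≡ v j → i ≡ j
  v-injective refl = refl

  u[]-injective : ∀ {x y} → u[ x ] ≡ u[ y ] → x ≈ y
  u[]-injective eq = fromℤ-injective (u-injective eq)

  v[]-injective : ∀ {x y} → v[ x ] ≡ v[ y ] → x ≈ y
  v[]-injective eq = fromℤ-injective (v-injective eq)

  toℤ-⊕ : ∀ i k → toℤ (i ⊕ k) ≈ toℤ i + + k
  toℤ-⊕ i k = subst₂ _≈_ (cong +_ (sym (FinP.toℕ-fromℕ< (ℕD.m%n<n (toℕ i ℕ.+ k) n))))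
                         (ℤP.pos-+ (toℕ i) k) (%ℕ-≈ (+ (toℕ i ℕ.+ k)))

  ⊕-fromℤ : ∀ i k → i ⊕ k ≡ fromℤ (toℤ i + + k)
  ⊕-fromℤ i k = toℤ-injective (≈-trans (toℤ-⊕ i k) (≈-sym (toℤ-fromℤ _)))

  even-index : ∀ {i} → IsEvenIdx i → Even (toℤ i)
  even-index {i} = %2≡0⇒even (toℤ i)

  UEdge-sym : ∀ {x y} → UEdge x y → UEdge y x
  UEdge-sym (fwd i) = bwd i
  UEdge-sym (bwd i) = fwd i

  VEdge-sym : ∀ {x y} → VEdge x y → VEdge y x
  VEdge-sym (fwdA i e) = bwdA i e
  VEdge-sym (bwdA i e) = fwdA i e
  VEdge-sym (fwdB i e) = bwdB i e
  VEdge-sym (bwdB i e) = fwdB i e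

  MEdge-sym : ∀ {x y} → MEdge x y → MEdge y x
  MEdge-sym (fwd i) = bwd i
  MEdge-sym (bwd i) = fwd i

  PartEdge-sym : ∀ P {x y} → PartEdge P x y → PartEdge P y x
  PartEdge-sym partU = UEdge-sym
  PartEdge-sym partV = VEdge-sym
  PartEdge-sym partM = MEdge-sym

  private
    ⊕-back : ∀ j k → toℤ (j ⊕ k) - + k ≈ toℤ j
    ⊕-back j k = ≈-trans (+-congʳ (- + k) (toℤ-⊕ j k)) (≈-reflexive (lemma (toℤ j) (+ k)))
      where lemma : ∀ x c → x + c - c ≡ x
            lemma = solve-∀

    fromℤ-shift : ∀ x c → fromℤ (toℤ (fromℤ x) + c) ≡ fromℤ (x + c)
    fromℤ-shift x c = fromℤ-cong (+-congʳ c (toℤ-fromℤ x))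

  u-step : ∀ x → UEdge u[ x ] u[ x + + 1 ]
  u-step x = subst (UEdge u[ x ]) (cong u (trans (⊕-fromℤ (fromℤ x) 1) (fromℤ-shift x (+ 1)))) (fwd (fromℤ x))

  u-step⁻ : ∀ x → UEdge u[ x ] u[ x - + 1 ]
  u-step⁻ x = subst (λ w → UEdge w u[ x - + 1 ]) (u[]-cong (≈-reflexive (lemma x))) (UEdge-sym (u-step (x - + 1)))
    where lemma : ∀ x → x - + 1 + + 1 ≡ x
          lemma = solve-∀

  u-neighboursᶠ : ∀ {i w} → UEdge (u i) w → w ≡ u[ toℤ i + + 1 ] ⊎ w ≡ u[ toℤ i - + 1 ]
  u-neighboursᶠ (fwd i) = inj₁ (cong u (⊕-fromℤ i 1))
  u-neighboursᶠ (bwd j) = inj₂ (trans (u-toℤ j) (u[]-cong (≈-sym (⊕-back j 1))))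

  u-neighbours : ∀ x {w} → UEdge u[ x ] w → w ≡ u[ x + + 1 ] ⊎ w ≡ u[ x - + 1 ]
  u-neighbours x e = Sum.map (λ eq → trans eq (cong u (fromℤ-shift x (+ 1))))
                             (λ eq → trans eq (cong u (fromℤ-shift x (- + 1)))) (u-neighboursᶠ e)

  v-neighboursᶠ : ∀ {i w} → VEdge (v i) w →
      Even (toℤ i) × (w ≡ v[ toℤ i + A ] ⊎ w ≡ v[ toℤ i + B ])
    ⊎ Odd (toℤ i) × (w ≡ v[ toℤ i - A ] ⊎ w ≡ v[ toℤ i - B ])
  v-neighboursᶠ (fwdA i e) = inj₁ (even-index e , inj₁ (cong v (⊕-fromℤ i a)))
  v-neighboursᶠ (fwdB i e) = inj₁ (even-index e , inj₂ (cong v (⊕-fromℤ i b)))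
  v-neighboursᶠ (bwdA j e) = inj₂ (≈-odd (≈-sym (toℤ-⊕ j a)) (even+odd (even-index e) A-odd)
                                  , inj₁ (trans (v-toℤ j) (v[]-cong (≈-sym (⊕-back j a)))))
  v-neighboursᶠ (bwdB j e) = inj₂ (≈-odd (≈-sym (toℤ-⊕ j b)) (even+odd (even-index e) B-odd)
                                  , inj₂ (trans (v-toℤ j) (v[]-cong (≈-sym (⊕-back j b)))))

  v-neighbours-even : ∀ {x w} → Even x → VEdge v[ x ] w → w ≡ v[ x + A ] ⊎ w ≡ v[ x + B ]
  v-neighbours-even {x} e edge with v-neighboursᶠ edge
  ... | inj₁ (_ , nb) = Sum.map (λ eq → trans eq (cong v (fromℤ-shift x A)))
                                (λ eq → trans eq (cong v (fromℤ-shift x B))) nb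
  ... | inj₂ (o , _) = ⊥-elim (even⇒¬odd e (≈-odd (toℤ-fromℤ x) o))

  v-neighbours-odd : ∀ {x w} → Odd x → VEdge v[ x ] w → w ≡ v[ x - A ] ⊎ w ≡ v[ x - B ]
  v-neighbours-odd {x} o edge with v-neighboursᶠ edge
  ... | inj₁ (e , _) = ⊥-elim (even⇒¬odd (≈-even (toℤ-fromℤ x) e) o)
  ... | inj₂ (_ , nb) = Sum.map (λ eq → trans eq (cong v (fromℤ-shift x (- A))))
                                (λ eq → trans eq (cong v (fromℤ-shift x (- B)))) nb

  v-jump : ∀ {x y} → Even x → y ≈ x + A ⊎ y ≈ x + B → VEdge v[ x ] v[ y ]
  v-jump {x} {y} e = Sum.[ (λ p → subst (VEdge v[ x ]) (landing a p) (fwdA (fromℤ x) even-fromℤ))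
                         , (λ p → subst (VEdge v[ x ]) (landing b p) (fwdB (fromℤ x) even-fromℤ)) ]
    where
    even-fromℤ : IsEvenIdx (fromℤ x)
    even-fromℤ = even⇒%2≡0 (≈-even (≈-sym (toℤ-fromℤ x)) e)
    landing : ∀ k → y ≈ x + + k → v (fromℤ x ⊕ k) ≡ v[ y ]
    landing k p = cong v (trans (⊕-fromℤ (fromℤ x) k) (trans (fromℤ-shift x (+ k)) (fromℤ-cong (≈-sym p))))

  M-unique : ∀ {x y z} → MEdge x y → MEdge x z → y ≡ z
  M-unique (fwd i) (fwd .i) = refl
  M-unique (bwd i) (bwd .i) = refl

  U-source : ∀ {x y} → UEdge x y → Σ (Fin n) λ i → x ≡ u i
  U-source (fwd i) = i , refl
  U-source (bwd i) = i ⊕ 1 , refl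

  V-source : ∀ {x y} → VEdge x y → Σ (Fin n) λ i → x ≡ v i
  V-source (fwdA i _) = i , refl
  V-source (bwdA i _) = i ⊕ a , refl
  V-source (fwdB i _) = i , refl
  V-source (bwdB i _) = i ⊕ b , refl

  U-degree≤2 : ∀ {x y₁ y₂ y₃} → UEdge x y₁ → UEdge x y₂ → UEdge x y₃ →
               y₁ ≡ y₂ ⊎ y₁ ≡ y₃ ⊎ y₂ ≡ y₃
  U-degree≤2 e₁ with U-source e₁
  ... | i , refl = pigeonhole u-neighboursᶠ e₁

  V-degree≤2 : ∀ {x y₁ y₂ y₃} → VEdge x y₁ → VEdge x y₂ → VEdge x y₃ →
               y₁ ≡ y₂ ⊎ y₁ ≡ y₃ ⊎ y₂ ≡ y₃
  V-degree≤2 e₁ with V-source e₁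
  ... | i , refl with even⊎odd (toℤ i)
  ...   | inj₁ e = pigeonhole (λ edge → Sum.[ proj₂ , (λ (o , _) → ⊥-elim (even⇒¬odd e o)) ]
                                             (v-neighboursᶠ edge)) e₁
  ...   | inj₂ o = pigeonhole (λ edge → Sum.[ (λ (e , _) → ⊥-elim (even⇒¬odd e o)) , proj₂ ]
                                             (v-neighboursᶠ edge)) e₁

  U∩V-edges≡∅ : ∀ {x y z} → UEdge x y → VEdge x z → ⊥
  U∩V-edges≡∅ (fwd i) ()
  U∩V-edges≡∅ (bwd i) ()

  incident-parts : ∀ {P Q x y₁ y₂ y₃} → PartEdge P x y₁ → PartEdge P x y₂ → PartEdge Q x y₃ →
                   y₁ ≢ y₂ → y₁ ≢ y₃ → y₂ ≢ y₃ → P ≢ partM × Q ≡ partM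
  incident-parts {partM} e₁ e₂ _ y₁≢y₂ _ _ = ⊥-elim (y₁≢y₂ (M-unique e₁ e₂))
  incident-parts {partU} {partU} e₁ e₂ e₃ y₁≢y₂ y₁≢y₃ y₂≢y₃ =
    ⊥-elim (Sum.[ y₁≢y₂ , Sum.[ y₁≢y₃ , y₂≢y₃ ] ] (U-degree≤2 e₁ e₂ e₃))
  incident-parts {partU} {partV} e₁ _ e₃ _ _ _ = ⊥-elim (U∩V-edges≡∅ e₁ e₃)
  incident-parts {partU} {partM} _ _ _ _ _ _ = (λ ()) , refl
  incident-parts {partV} {partU} e₁ _ e₃ _ _ _ = ⊥-elim (U∩V-edges≡∅ e₃ e₁)
  incident-parts {partV} {partV} e₁ e₂ e₃ y₁≢y₂ y₁≢y₃ y₂≢y₃ =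
    ⊥-elim (Sum.[ y₁≢y₂ , Sum.[ y₁≢y₃ , y₂≢y₃ ] ] (V-degree≤2 e₁ e₂ e₃))
  incident-parts {partV} {partM} _ _ _ _ _ _ = (λ ()) , refl

  matched-cycle-parts : ∀ {P x y w z} → MEdge x y → PartEdge P x w → PartEdge P y z → P ≡ partM
  matched-cycle-parts {partU} (fwd i) _ ()
  matched-cycle-parts {partU} (bwd i) () _
  matched-cycle-parts {partV} (fwd i) () _
  matched-cycle-parts {partV} (bwd i) _ ()
  matched-cycle-parts {partM} _ _ _ = refl

  exchange : Part → Part
  exchange partU = partV
  exchange partV = partU
  exchange partM = partM

  PartsFollow : (Part → Part) → (Vert → Vert) → Set
  PartsFollow τ g = ∀ P x y → PartEdge P x y ⇔ PartEdge (τ P) (g x) (g y)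

  record PartitionInjection (g : Vert → Vert) : Set where
    field
      injective : ∀ {x y} → g x ≡ g y → x ≡ y
      preserves-partition : PreservesPartition g

  module Swap (π κ : ℤ) (labels : Labelling (π * + 2 + + 1) (κ * + 2 + + 1)) where

    P Q δ h K : ℤ
    P = π * + 2 + + 1
    Q = κ * + 2 + + 1
    δ = κ - π
    h = π + κ + + 1
    K = h - δ * P

    -- σ x = - δ x for even x and h - δ x for odd x, the parity bit x %ℕ 2 selecting the case.
    σ : ℤ → ℤ
    σ x = h * + (x ℤ.%ℕ 2) - δ * x

    σ-even : ∀ {x} → Even x → σ x ≡ - δ * x
    σ-even {x} e = trans (cong (λ r → h * + r - δ * x) (even⇒%2≡0 e)) (lemma h δ x)
      where lemma : ∀ h δ x → h * + 0 - δ * x ≡ - δ * x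
            lemma = solve-∀

    σ-odd : ∀ {x} → Odd x → σ x ≡ h - δ * x
    σ-odd {x} o = trans (cong (λ r → h * + r - δ * x) (odd⇒%2≡1 o)) (lemma h δ x)
      where lemma : ∀ h δ x → h * + 1 - δ * x ≡ h - δ * x
            lemma = solve-∀

    σ-cong : ∀ {x y} → x ≈ y → σ x ≈ σ y
    σ-cong p = +-cong (≈-reflexive (cong (λ r → h * + r) (≈₂⇒%2≡ (≈⇒≈₂ p)))) (-‿cong (*-congˡ δ p))

    σ-preserves-even : ∀ {x} → Even x → Even (σ x)
    σ-preserves-even e = subst Even (sym (σ-even e)) (even-*ˡ (- δ) e)

    σ-preserves-odd : ∀ {x} → Odd x → Odd (σ x)
    σ-preserves-odd {x} o =
      subst Odd (sym (trans (σ-odd o) (lemma π κ x))) (odd+even (odd-2k+1 π) (even-*ˡ (- δ) (even-pred o)))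
      where lemma : ∀ π κ x → (π + κ + + 1) - (κ - π) * x ≡ π * + 2 + + 1 + - (κ - π) * (x - + 1)
            lemma = solve-∀

    σ-suc-even : ∀ {x} → Even x → σ (x + + 1) ≡ σ x + P
    σ-suc-even {x} e = trans (σ-odd (odd-suc e)) (trans (lemma π κ x) (cong (_+ P) (sym (σ-even e))))
      where lemma : ∀ π κ x → (π + κ + + 1) - (κ - π) * (x + + 1) ≡ - (κ - π) * x + (π * + 2 + + 1)
            lemma = solve-∀

    σ-pred-even : ∀ {x} → Even x → σ (x - + 1) ≡ σ x + Q
    σ-pred-even {x} e = trans (σ-odd (odd-pred e)) (trans (lemma π κ x) (cong (_+ Q) (sym (σ-even e))))
      where lemma : ∀ π κ x → (π + κ + + 1) - (κ - π) * (x - + 1) ≡ - (κ - π) * x + (κ * + 2 + + 1)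
            lemma = solve-∀

    σ-suc-odd : ∀ {x} → Odd x → σ (x + + 1) ≡ σ x - Q
    σ-suc-odd {x} o = trans (σ-even (even-suc o)) (trans (lemma π κ x) (cong (_- Q) (sym (σ-odd o))))
      where lemma : ∀ π κ x → - (κ - π) * (x + + 1) ≡ (π + κ + + 1) - (κ - π) * x - (κ * + 2 + + 1)
            lemma = solve-∀

    σ-pred-odd : ∀ {x} → Odd x → σ (x - + 1) ≡ σ x - P
    σ-pred-odd {x} o = trans (σ-even (even-pred o)) (trans (lemma π κ x) (cong (_- P) (sym (σ-odd o))))
      where lemma : ∀ π κ x → - (κ - π) * (x - + 1) ≡ (π + κ + + 1) - (κ - π) * x - (π * + 2 + + 1)
            lemma = solve-∀

    σ-shift : ∀ {x y} → Even x → Odd y → σ (x + y) ≡ σ x + σ y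
    σ-shift {x} {y} e o = trans (σ-odd (even+odd e o)) (trans (lemma h δ x y) (sym (cong₂ _+_ (σ-even e) (σ-odd o))))
      where lemma : ∀ h δ x y → h - δ * (x + y) ≡ - δ * x + (h - δ * y)
            lemma = solve-∀

    σ-P : σ P ≡ K
    σ-P = σ-odd (odd-2k+1 π)

    σ-Q : σ Q ≡ K - δ * δ * + 2
    σ-Q = trans (σ-odd (odd-2k+1 κ)) (lemma π κ)
      where lemma : ∀ π κ → (π + κ + + 1) - (κ - π) * (κ * + 2 + + 1)
                          ≡ (π + κ + + 1) - (κ - π) * (π * + 2 + + 1) - (κ - π) * (κ - π) * + 2
            lemma = solve-∀

    as-labels : ∀ {X : Set} {w : X} (f : ℤ → X) → w ≡ f A ⊎ w ≡ f B → w ≡ f P ⊎ w ≡ f Q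
    as-labels {X} {w} f = relabel labels
      where
      relabel : Labelling P Q → w ≡ f A ⊎ w ≡ f B → w ≡ f P ⊎ w ≡ f Q
      relabel (inj₁ (P≡A , Q≡B)) = Sum.map (λ eq → trans eq (cong f (sym P≡A)))
                                           (λ eq → trans eq (cong f (sym Q≡B)))
      relabel (inj₂ (P≡B , Q≡A)) = Sum.swap ∘ Sum.map (λ eq → trans eq (cong f (sym Q≡A)))
                                                      (λ eq → trans eq (cong f (sym P≡B)))

    from-labels : ∀ {x y} → y ≈ x + P ⊎ y ≈ x + Q → y ≈ x + A ⊎ y ≈ x + B
    from-labels {x} {y} = relabel labels
      where
      relabel : Labelling P Q → y ≈ x + P ⊎ y ≈ x + Q → y ≈ x + A ⊎ y ≈ x + B
      relabel (inj₁ (P≡A , Q≡B)) = Sum.map (subst (λ c → y ≈ x + c) P≡A) (subst (λ c → y ≈ x + c) Q≡B)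
      relabel (inj₂ (P≡B , Q≡A)) =
        Sum.swap ∘ Sum.map (subst (λ c → y ≈ x + c) P≡B) (subst (λ c → y ≈ x + c) Q≡A)

    P+Q≡A+B : P + Q ≡ A + B
    P+Q≡A+B = Sum.[ (λ (P≡A , Q≡B) → cong₂ _+_ P≡A Q≡B)
                  , (λ (P≡B , Q≡A) → trans (cong₂ _+_ P≡B Q≡A) (ℤP.+-comm B A)) ]′ labels

    σ-neighbours : ∀ x {w} → VEdge v[ σ x ] w → w ≡ v[ σ (x - + 1) ] ⊎ w ≡ v[ σ (x + + 1) ]
    σ-neighbours x e with even⊎odd x
    ... | inj₁ ev = Sum.swap (Sum.map (λ eq → trans eq (cong v[_] (sym (σ-suc-even ev))))
                                      (λ eq → trans eq (cong v[_] (sym (σ-pred-even ev))))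
                                      (as-labels (λ c → v[ σ x + c ]) (v-neighbours-even (σ-preserves-even ev) e)))
    ... | inj₂ od = Sum.map (λ eq → trans eq (cong v[_] (sym (σ-pred-odd od))))
                            (λ eq → trans eq (cong v[_] (sym (σ-suc-odd od))))
                            (as-labels (λ c → v[ σ x - c ]) (v-neighbours-odd (σ-preserves-odd od) e))

    σ-adjacent : ∀ x → VEdge v[ σ x ] v[ σ (x + + 1) ]
    σ-adjacent x with even⊎odd x
    ... | inj₁ ev = v-jump (σ-preserves-even ev) (from-labels {σ x} (inj₁ (≈-reflexive (σ-suc-even ev))))
    ... | inj₂ od = VEdge-sym (v-jump (σ-preserves-even (even-suc od)) (from-labels {σ (x + + 1)} (inj₂ (≈-reflexive back))))
      where back : σ x ≡ σ (x + + 1) + Q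
            back = trans (lemma (σ x) Q) (cong (_+ Q) (sym (σ-suc-odd od)))
              where lemma : ∀ s q → s ≡ s - q + q
                    lemma = solve-∀

    Admissible : Set
    Admissible = δ * δ * + 2 ≈ + 2 × K ≈ + 1

    negative-signs⇒A+B≈0 : K ≈ - + 1 → δ * δ * + 2 ≈ - + 2 → A + B ≈ + 0
    negative-signs⇒A+B≈0 K≈-1 2δ²≈-2 = begin
      A + B                                            ≡⟨ sym P+Q≡A+B ⟩
      P + Q                                            ≡⟨ lemma π κ ⟩
      (+ 1 + δ) * (K + + 1) + π * (δ * δ * + 2 + + 2)  ≈⟨ +-cong (*-congˡ (+ 1 + δ) (+-congʳ (+ 1) K≈-1))
                                                                  (*-congˡ π (+-congʳ (+ 2) 2δ²≈-2)) ⟩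
      (+ 1 + δ) * (- + 1 + + 1) + π * (- + 2 + + 2)    ≡⟨ lemma₀ (+ 1 + δ) π ⟩
      + 0                                              ∎
      where
      open ≈-Reasoning
      lemma : ∀ π κ → π * + 2 + + 1 + (κ * + 2 + + 1)
                    ≡ (+ 1 + (κ - π)) * ((π + κ + + 1) - (κ - π) * (π * + 2 + + 1) + + 1)
                      + π * ((κ - π) * (κ - π) * + 2 + + 2)
      lemma = solve-∀
      lemma₀ : ∀ c d → c * (- + 1 + + 1) + d * (- + 2 + + 2) ≡ + 0
      lemma₀ = solve-∀

    2δ²≡K-σQ : δ * δ * + 2 ≡ K - σ Q
    2δ²≡K-σQ = trans (lemma K (δ * δ * + 2)) (cong (_-_ K) (sym σ-Q))
      where lemma : ∀ k d → d ≡ k - (k - d)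
            lemma = solve-∀

    signs : σ P ≈ + 1 ⊎ σ P ≈ - + 1 → σ Q ≈ + 1 ⊎ σ Q ≈ - + 1 → ¬ σ P ≈ σ Q → Admissible ⊎ A + B ≈ + 0
    signs (inj₁ p) (inj₁ q) σP≉σQ = ⊥-elim (σP≉σQ (≈-trans p (≈-sym q)))
    signs (inj₂ p) (inj₂ q) σP≉σQ = ⊥-elim (σP≉σQ (≈-trans p (≈-sym q)))
    signs (inj₁ p) (inj₂ q) _ =
      inj₁ (subst (_≈ + 2) (sym 2δ²≡K-σQ) (+-cong K≈1 (-‿cong q)) , K≈1)
      where K≈1 : K ≈ + 1
            K≈1 = subst (_≈ + 1) σ-P p
    signs (inj₂ p) (inj₁ q) _ =
      inj₂ (negative-signs⇒A+B≈0 K≈-1 (subst (_≈ - + 2) (sym 2δ²≡K-σQ) (+-cong K≈-1 (-‿cong q))))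
      where K≈-1 : K ≈ - + 1
            K≈-1 = subst (_≈ - + 1) σ-P p

    σ-involutive : Admissible → ∀ x → σ (σ x) ≈ x
    σ-involutive (2δ²≈2 , K≈1) x with even⊎odd x
    ... | inj₁ e@(mk (divides t x-0≡2t)) = begin
      σ (σ x)                  ≡⟨ σ-even (σ-preserves-even e) ⟩
      - δ * σ x                ≡⟨ cong (_*_ (- δ)) (σ-even e) ⟩
      - δ * (- δ * x)          ≡⟨ cong (λ z → - δ * (- δ * z)) x≡2t ⟩
      - δ * (- δ * (t * + 2))  ≡⟨ lemma δ t ⟩
      t * (δ * δ * + 2)        ≈⟨ *-congˡ t 2δ²≈2 ⟩
      t * + 2                  ≡⟨ sym x≡2t ⟩
      x                        ∎
      where
      open ≈-Reasoning
      x≡2t : x ≡ t * + 2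
      x≡2t = trans (sym (ℤP.+-identityʳ x)) x-0≡2t
      lemma : ∀ δ t → - δ * (- δ * (t * + 2)) ≡ t * (δ * δ * + 2)
      lemma = solve-∀
    ... | inj₂ o@(mk (divides t x-1≡2t)) = begin
      σ (σ x)                            ≡⟨ σ-odd (σ-preserves-odd o) ⟩
      h - δ * σ x                        ≡⟨ cong (λ z → h - δ * z) (σ-odd o) ⟩
      h - δ * (h - δ * x)                ≡⟨ cong (λ z → h - δ * (h - δ * z)) x≡2t+1 ⟩
      h - δ * (h - δ * (t * + 2 + + 1))  ≡⟨ lemma π κ t ⟩
      K + t * (δ * δ * + 2)              ≈⟨ +-cong K≈1 (*-congˡ t 2δ²≈2) ⟩
      + 1 + t * + 2                      ≡⟨ trans (ℤP.+-comm (+ 1) (t * + 2)) (sym x≡2t+1) ⟩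
      x                                  ∎
      where
      open ≈-Reasoning
      x≡2t+1 : x ≡ t * + 2 + + 1
      x≡2t+1 = trans (lemma₁ x) (cong (_+ + 1) x-1≡2t)
        where lemma₁ : ∀ x → x ≡ x - + 1 + + 1
              lemma₁ = solve-∀
      lemma : ∀ π κ t → (π + κ + + 1) - (κ - π) * ((π + κ + + 1) - (κ - π) * (t * + 2 + + 1))
                      ≡ (π + κ + + 1) - (κ - π) * (π * + 2 + + 1) + t * ((κ - π) * (κ - π) * + 2)
      lemma = solve-∀

    σ-jumps : Admissible → ∀ {x} → Even x → UEdge u[ σ x ] u[ σ (x + A) ] × UEdge u[ σ x ] u[ σ (x + B) ]
    σ-jumps (2δ²≈2 , K≈1) {x} e =
      Sum.[ (λ (P≡A , Q≡B) → subst₂ _×_ (target P≡A) (target Q≡B) (jump-P , jump-Q))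
          , (λ (P≡B , Q≡A) → subst₂ _×_ (target Q≡A) (target P≡B) (jump-Q , jump-P)) ]′ labels
      where
      target : ∀ {c d} → c ≡ d → UEdge u[ σ x ] u[ σ (x + c) ] ≡ UEdge u[ σ x ] u[ σ (x + d) ]
      target = cong (λ c → UEdge u[ σ x ] u[ σ (x + c) ])
      jump-P : UEdge u[ σ x ] u[ σ (x + P) ]
      jump-P = subst (UEdge u[ σ x ]) (u[]-cong (≈-sym σ[x+P]≈σx+1)) (u-step (σ x))
        where σ[x+P]≈σx+1 : σ (x + P) ≈ σ x + + 1
              σ[x+P]≈σx+1 = ≈-trans (≈-reflexive (trans (σ-shift e (odd-2k+1 π)) (cong (_+_ (σ x)) σ-P)))
                                    (+-cong (≈-refl {σ x}) K≈1)
      jump-Q : UEdge u[ σ x ] u[ σ (x + Q) ]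
      jump-Q = subst (UEdge u[ σ x ]) (u[]-cong (≈-sym σ[x+Q]≈σx-1)) (u-step⁻ (σ x))
        where σ[x+Q]≈σx-1 : σ (x + Q) ≈ σ x - + 1
              σ[x+Q]≈σx-1 = ≈-trans (≈-reflexive (trans (σ-shift e (odd-2k+1 κ)) (cong (_+_ (σ x)) σ-Q)))
                                    (+-cong (≈-refl {σ x}) (+-cong K≈1 (-‿cong 2δ²≈2)))

    halved-square≡2δ² : ((B - A) * (B - A)) ℤ./ + 2 ≡ δ * δ * + 2
    halved-square≡2δ² =
      Sum.[ (λ (P≡A , Q≡B) → subst₂ HalvedSquare P≡A Q≡B (halve (lemma₁ π κ)))
          , (λ (P≡B , Q≡A) → subst₂ HalvedSquare Q≡A P≡B (halve (lemma₂ π κ))) ]′ labels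
      where
      HalvedSquare : ℤ → ℤ → Set
      HalvedSquare x y = ((y - x) * (y - x)) ℤ./ + 2 ≡ δ * δ * + 2
      halve : ∀ {z} → z ≡ δ * δ * + 2 * + 2 → z ℤ./ + 2 ≡ δ * δ * + 2
      halve eq = trans (cong (ℤ._/ + 2) eq) (*2/2 (δ * δ * + 2))
      lemma₁ : ∀ π κ → (κ * + 2 + + 1 - (π * + 2 + + 1)) * (κ * + 2 + + 1 - (π * + 2 + + 1))
                     ≡ (κ - π) * (κ - π) * + 2 * + 2
      lemma₁ = solve-∀
      lemma₂ : ∀ π κ → (π * + 2 + + 1 - (κ * + 2 + + 1)) * (π * + 2 + + 1 - (κ * + 2 + + 1))
                     ≡ (κ - π) * (κ - π) * + 2 * + 2
      lemma₂ = solve-∀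

    P-correction≡K : P + ((P - + 1) * (P - Q)) ℤ./ + 2 ≡ K
    P-correction≡K =
      trans (cong (_+_ P) (trans (cong (ℤ._/ + 2) (lemma₁ π κ)) (*2/2 (π * (π - κ) * + 2)))) (lemma₂ π κ)
      where
      lemma₁ : ∀ π κ → (π * + 2 + + 1 - + 1) * (π * + 2 + + 1 - (κ * + 2 + + 1)) ≡ π * (π - κ) * + 2 * + 2
      lemma₁ = solve-∀
      lemma₂ : ∀ π κ → π * + 2 + + 1 + π * (π - κ) * + 2 ≡ (π + κ + + 1) - (κ - π) * (π * + 2 + + 1)
      lemma₂ = solve-∀

  module _ (2<n : 2 < n) where

    2≉0 : ¬ (+ 2 ≈ + 0)
    2≉0 p = ℕP.1+n≢0 (residue-injective 2<n (ℕP.<-trans (ℕ.s≤s ℕ.z≤n) 2<n) p)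

    u[x+1]≢u[x-1] : ∀ x → u[ x + + 1 ] ≢ u[ x - + 1 ]
    u[x+1]≢u[x-1] x eq = 2≉0 (subst (_≈ + 0) (lemma x) (≈⇒-≈0 (u[]-injective {x + + 1} {x - + 1} eq)))
      where lemma : ∀ x → x + + 1 - (x - + 1) ≡ + 2
            lemma = solve-∀

    u[x+2]≢u[x] : ∀ x → u[ x + + 2 ] ≢ u[ x ]
    u[x+2]≢u[x] x eq = 2≉0 (subst (_≈ + 0) (lemma x) (≈⇒-≈0 (u[]-injective {x + + 2} {x} eq)))
      where lemma : ∀ x → x + + 2 - x ≡ + 2
            lemma = solve-∀

    preserves-or-exchanges : ∀ {g} → PartitionInjection g → PartsFollow (λ P → P) g ⊎ PartsFollow exchange g
    preserves-or-exchanges {g} G = decide (image-part partU) (image-part partV) refl refl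
      where
      open PartitionInjection G

      image-part : Part → Part
      image-part P = proj₁ (preserves-partition P)

      image : ∀ P {x y} → PartEdge P x y → PartEdge (image-part P) (g x) (g y)
      image P e = Equivalence.to (proj₂ (preserves-partition P) _ _) e

      g-distinct : ∀ {x y} → x ≢ y → g x ≢ g y
      g-distinct x≢y eq = x≢y (injective eq)

      u≢v : ∀ {i j} → u i ≢ v j
      u≢v ()

      parts-at-u₀ : image-part partU ≢ partM × image-part partM ≡ partM
      parts-at-u₀ = incident-parts (image partU (u-step (+ 0))) (image partU (u-step⁻ (+ 0)))
                                   (image partM (fwd (fromℤ (+ 0))))
                                   (g-distinct (u[x+1]≢u[x-1] (+ 0))) (g-distinct u≢v) (g-distinct u≢v)

      matching-at-u₀ : MEdge (g u[ + 0 ]) (g v[ + 0 ])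
      matching-at-u₀ = subst (λ Q → PartEdge Q _ _) (proj₂ parts-at-u₀) (image partM (fwd (fromℤ (+ 0))))

      V-edge-at-v₀ : PartEdge (image-part partV) (g v[ + 0 ]) (g v[ + 0 + A ])
      V-edge-at-v₀ = image partV (v-jump even-0 (inj₁ ≈-refl))

      V-image≢M : image-part partV ≢ partM
      V-image≢M eq = u≢v (sym (injective (M-unique (subst (λ Q → PartEdge Q _ _) eq V-edge-at-v₀)
                                                   (MEdge-sym matching-at-u₀))))

      U-image≢V-image : image-part partU ≢ image-part partV
      U-image≢V-image eq = proj₁ parts-at-u₀ (matched-cycle-parts matching-at-u₀ (image partU (u-step (+ 0)))
                                                (subst (λ Q → PartEdge Q _ _) (sym eq) V-edge-at-v₀))

      follow : ∀ τ → (∀ P → image-part P ≡ τ P) → PartsFollow τ g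
      follow τ eq P = subst (λ Q → ∀ x y → PartEdge P x y ⇔ PartEdge Q (g x) (g y)) (eq P)
                            (proj₂ (preserves-partition P))

      decide : ∀ QU QV → image-part partU ≡ QU → image-part partV ≡ QV →
               PartsFollow (λ P → P) g ⊎ PartsFollow exchange g
      decide partU partV eqU eqV = inj₁ (follow _ λ { partU → eqU ; partV → eqV ; partM → proj₂ parts-at-u₀ })
      decide partV partU eqU eqV = inj₂ (follow _ λ { partU → eqU ; partV → eqV ; partM → proj₂ parts-at-u₀ })
      decide partU partU eqU eqV = ⊥-elim (U-image≢V-image (trans eqU (sym eqV)))
      decide partV partV eqU eqV = ⊥-elim (U-image≢V-image (trans eqU (sym eqV)))
      decide partM _     eqU _   = ⊥-elim (proj₁ parts-at-u₀ eqU)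
      decide _     partM _   eqV = ⊥-elim (V-image≢M eqV)

    matching-preserved : ∀ {g} → PartitionInjection g → ∀ {x y} → MEdge x y → MEdge (g x) (g y)
    matching-preserved G e = Sum.[ (λ f → Equivalence.to (f partM _ _) e) , (λ f → Equivalence.to (f partM _ _) e) ]′
                                   (preserves-or-exchanges G)

    u-image-follows-path : ∀ {g Q} → PartitionInjection g → (∀ {x y} → UEdge x y → PartEdge Q (g x) (g y)) →
      (p : ℤ → Vert) → (∀ {x y} → x ≈ y → p x ≡ p y) →
      (∀ x {w} → PartEdge Q (p x) w → w ≡ p (x - + 1) ⊎ w ≡ p (x + + 1)) →
      ∀ c → g u[ c ] ≡ p c → g u[ c + + 1 ] ≡ p (c + + 1) → ∀ x → g u[ x ] ≡ p x
    u-image-follows-path {g} {Q} G g-maps p p-cong p-neighbours c start next x =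
      trans (cong g (u[]-cong (≈-sym c+k≈x))) (trans (along k) (p-cong c+k≈x))
      where
      open PartitionInjection G
      k : ℕ
      k = toℕ (fromℤ (x - c))
      c+k≈x : c + + k ≈ x
      c+k≈x = ≈-trans (+-cong (≈-refl {c}) (toℤ-fromℤ (x - c))) (≈-reflexive (lemma c x))
        where lemma : ∀ c x → c + (x - c) ≡ x
              lemma = solve-∀
      down : ∀ c k → c + (+ 1 + k) - + 1 ≈ c + k
      down c k = ≈-reflexive (lemma c k)
        where lemma : ∀ c k → c + (+ 1 + k) - + 1 ≡ c + k
              lemma = solve-∀
      up : ∀ c k → c + (+ 1 + k) + + 1 ≈ c + (+ 1 + (+ 1 + k))
      up c k = ≈-reflexive (lemma c k)
        where lemma : ∀ c k → c + (+ 1 + k) + + 1 ≡ c + (+ 1 + (+ 1 + k))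
              lemma = solve-∀
      along : ∀ k → g u[ c + + k ] ≡ p (c + + k)
      along = non-backtracking-walk≡path (PartEdge Q) (λ k → p (c + + k)) (λ k → g u[ c + + k ])
        (λ k e → Sum.map (λ eq → trans eq (p-cong (down c (+ k)))) (λ eq → trans eq (p-cong (up c (+ k))))
                         (p-neighbours (c + + ℕ.suc k) e))
        (λ k → g-maps (subst (UEdge _) (u[]-cong (up c (+ k))) (u-step (c + + ℕ.suc k))))
        (λ k eq → u[x+2]≢u[x] (c + + k) (trans (u[]-cong (≈-reflexive (lemma c (+ k)))) (injective eq)))
        (trans (cong (λ z → g u[ z ]) (ℤP.+-identityʳ c)) (trans start (cong p (sym (ℤP.+-identityʳ c)))))
        next
        where lemma : ∀ c k → c + k + + 2 ≡ c + (+ 1 + (+ 1 + k))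
              lemma = solve-∀

module Symmetries (n : ℕ) .{{_ : NonZero n}} (n-even : n % 2 ≡ 0) (a b : ℕ) (a-odd : a % 2 ≡ 1) (b-odd : b % 2 ≡ 1) where

  open Graph n a b
  open Congruence n
  open Residues n
  open Parity
  open Edges n n-even a b a-odd b-odd

  Involutive : (Part → Part) → Set
  Involutive τ = ∀ P → τ (τ P) ≡ P

  id-involutive : Involutive (λ P → P)
  id-involutive P = refl

  exchange-involutive : Involutive exchange
  exchange-involutive partU = refl
  exchange-involutive partV = refl
  exchange-involutive partM = refl

  PartsTo : (Part → Part) → (Vert → Vert) → Set
  PartsTo τ g = ∀ P {x y} → PartEdge P x y → PartEdge (τ P) (g x) (g y)

  parts-follow : ∀ {τ g h} → Involutive τ → (∀ x → h (g x) ≡ x) → PartsTo τ g → PartsTo τ h → PartsFollow τ g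
  parts-follow {τ} {g} {h} τ² hg g-to h-to P x y = mk⇔ (g-to P) back
    where back : PartEdge (τ P) (g x) (g y) → PartEdge P x y
          back e = subst₂ (PartEdge P) (hg x) (hg y)
                          (subst (λ Q → PartEdge Q (h (g x)) (h (g y))) (τ² P) (h-to (τ P) e))

  Adj⇔PartEdge : ∀ {x y} → Adj x y ⇔ Σ Part λ P → PartEdge P x y
  Adj⇔PartEdge = mk⇔ (Sum.[ (partU ,_) , Sum.[ (partV ,_) , (partM ,_) ]′ ]′)
                     (λ { (partU , e) → inj₁ e ; (partV , e) → inj₂ (inj₁ e) ; (partM , e) → inj₂ (inj₂ e) })

  parts-follow⇒preserves-adj : ∀ {τ g} → Involutive τ → PartsFollow τ g → PreservesAdj g
  parts-follow⇒preserves-adj {τ} {g} τ² follow x y = mk⇔ forth back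
    where
    forth : Adj x y → Adj (g x) (g y)
    forth adj with Equivalence.to Adj⇔PartEdge adj
    ... | P , e = Equivalence.from Adj⇔PartEdge (τ P , Equivalence.to (follow P x y) e)
    back : Adj (g x) (g y) → Adj x y
    back adj with Equivalence.to Adj⇔PartEdge adj
    ... | Q , e = Equivalence.from Adj⇔PartEdge
                    (τ Q , Equivalence.from (follow (τ Q) x y) (subst (λ R → PartEdge R _ _) (sym (τ² Q)) e))

  Aut : (Vert → Vert) → Set
  Aut g = PreservesAdj g × PreservesPartition g

  record Symmetry (g : Vert → Vert) : Set where
    field
      inverse  : Vert → Vert
      inverseˡ : ∀ x → inverse (g x) ≡ x
      inverseʳ : ∀ x → g (inverse x) ≡ x
      aut      : Aut g
      aut⁻¹    : Aut inverse

  symmetry-inverse : ∀ {g} (S : Symmetry g) → Symmetry (Symmetry.inverse S)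
  symmetry-inverse {g} S =
    record { inverse = g ; inverseˡ = inverseʳ ; inverseʳ = inverseˡ ; aut = aut⁻¹ ; aut⁻¹ = aut }
    where open Symmetry S

  aut-∘ : ∀ {f g} → Aut f → Aut g → Aut (f ∘ g)
  aut-∘ {f} {g} (adj-f , part-f) (adj-g , part-g) = (λ x y → adj-f (g x) (g y) ∘⇔ adj-g x y) , part
    where
    _∘⇔_ : ∀ {X Y Z : Set} → Y ⇔ Z → X ⇔ Y → X ⇔ Z
    q ∘⇔ p = mk⇔ (Equivalence.to q ∘ Equivalence.to p) (Equivalence.from p ∘ Equivalence.from q)
    part : PreservesPartition (f ∘ g)
    part P with part-g P
    ... | Q , eg with part-f Q
    ...   | R , ef = R , λ x y → ef (g x) (g y) ∘⇔ eg x y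

  symmetry-∘ : ∀ {f g} → Symmetry f → Symmetry g → Symmetry (f ∘ g)
  symmetry-∘ {f} {g} F G = record
    { inverse  = G.inverse ∘ F.inverse
    ; inverseˡ = λ x → trans (cong G.inverse (F.inverseˡ (g x))) (G.inverseˡ x)
    ; inverseʳ = λ x → trans (cong f (G.inverseʳ (F.inverse x))) (F.inverseʳ x)
    ; aut      = aut-∘ F.aut G.aut
    ; aut⁻¹    = aut-∘ G.aut⁻¹ F.aut⁻¹
    }
    where module F = Symmetry F
          module G = Symmetry G

  symmetry-id : Symmetry (λ x → x)
  symmetry-id =
    record { inverse = λ x → x ; inverseˡ = λ _ → refl ; inverseʳ = λ _ → refl ; aut = aut-id ; aut⁻¹ = aut-id }
    where aut-id : Aut (λ x → x)
          aut-id = (λ _ _ → mk⇔ (λ e → e) (λ e → e)) , (λ P → P , λ _ _ → mk⇔ (λ e → e) (λ e → e))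

  symmetries-form-group : IsPermGroup Symmetry
  symmetries-form-group = record
    { has-id  = symmetry-id
    ; has-∘   = symmetry-∘
    ; has-inv = λ S → Symmetry.inverse S , symmetry-inverse S , Symmetry.inverseˡ S , Symmetry.inverseʳ S
    }

  symmetry⇒partition-injection : ∀ {g} → Symmetry g → PartitionInjection g
  symmetry⇒partition-injection S = record
    { injective = λ {x} {y} eq → trans (sym (inverseˡ x)) (trans (cong inverse eq) (inverseˡ y))
    ; preserves-partition = proj₂ aut }
    where open Symmetry S

  symmetry-from-parts : ∀ {τ g h} → Involutive τ → (∀ x → h (g x) ≡ x) → (∀ x → g (h x) ≡ x) →
                        PartsTo τ g → PartsTo τ h → Symmetry g
  symmetry-from-parts τ² hg gh g-to h-to = record
    { inverse = _ ; inverseˡ = hg ; inverseʳ = gh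
    ; aut   = aut-of (parts-follow τ² hg g-to h-to)
    ; aut⁻¹ = aut-of (parts-follow τ² gh h-to g-to) }
    where
    aut-of : ∀ {f} → PartsFollow _ f → Aut f
    aut-of follow = parts-follow⇒preserves-adj τ² follow , λ P → _ , follow P

  lift : (ℤ → Vert) → (ℤ → Vert) → (ℤ → ℤ) → Vert → Vert
  lift p q φ (u i) = p (φ (toℤ i))
  lift p q φ (v i) = q (φ (toℤ i))

  lift-parts : ∀ τ {p q φ} →
    (∀ {x y} → x ≈ y → p x ≡ p y) → (∀ {x y} → x ≈ y → q x ≡ q y) → (∀ {x y} → x ≈ y → φ x ≈ φ y) →
    (∀ x → PartEdge (τ partU) (p (φ x)) (p (φ (x + + 1)))) →
    (∀ {x} → Even x → PartEdge (τ partV) (q (φ x)) (q (φ (x + A))) × PartEdge (τ partV) (q (φ x)) (q (φ (x + B)))) →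
    (∀ y → PartEdge (τ partM) (p y) (q y)) →
    PartsTo τ (lift p q φ)
  lift-parts τ {p} {q} {φ} p-cong q-cong φ-cong steps jumps matching = edges
    where
    along : ∀ {r : ℤ → Vert} → (∀ {x y} → x ≈ y → r x ≡ r y) →
            ∀ i k → r (φ (toℤ i + + k)) ≡ r (φ (toℤ (i ⊕ k)))
    along r-cong i k = r-cong (φ-cong (≈-sym (toℤ-⊕ i k)))
    edges : PartsTo τ (lift p q φ)
    edges partU (fwd i)    = subst (PartEdge (τ partU) _) (along p-cong i 1) (steps (toℤ i))
    edges partU (bwd i)    = PartEdge-sym (τ partU) (edges partU (fwd i))
    edges partV (fwdA i e) = subst (PartEdge (τ partV) _) (along q-cong i a) (proj₁ (jumps (even-index e)))
    edges partV (bwdA i e) = PartEdge-sym (τ partV) (edges partV (fwdA i e))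
    edges partV (fwdB i e) = subst (PartEdge (τ partV) _) (along q-cong i b) (proj₂ (jumps (even-index e)))
    edges partV (bwdB i e) = PartEdge-sym (τ partV) (edges partV (fwdB i e))
    edges partM (fwd i)    = matching _
    edges partM (bwd i)    = PartEdge-sym (τ partM) (matching _)

  induced induced-swap : (ℤ → ℤ) → Vert → Vert
  induced = lift u[_] v[_]
  induced-swap = lift v[_] u[_]

  induced-inverse : ∀ {φ ψ} → (∀ {x y} → x ≈ y → ψ x ≈ ψ y) → (∀ x → ψ (φ x) ≈ x) →
                    ∀ z → induced ψ (induced φ z) ≡ z
  induced-inverse ψ-cong ψφ (u i) = trans (u[]-cong (≈-trans (ψ-cong (toℤ-fromℤ _)) (ψφ (toℤ i)))) (sym (u-toℤ i))
  induced-inverse ψ-cong ψφ (v i) = trans (v[]-cong (≈-trans (ψ-cong (toℤ-fromℤ _)) (ψφ (toℤ i)))) (sym (v-toℤ i))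

  induced-swap-inverse : ∀ {φ ψ} → (∀ {x y} → x ≈ y → ψ x ≈ ψ y) → (∀ x → ψ (φ x) ≈ x) →
                         ∀ z → induced-swap ψ (induced-swap φ z) ≡ z
  induced-swap-inverse ψ-cong ψφ (u i) =
    trans (u[]-cong (≈-trans (ψ-cong (toℤ-fromℤ _)) (ψφ (toℤ i)))) (sym (u-toℤ i))
  induced-swap-inverse ψ-cong ψφ (v i) =
    trans (v[]-cong (≈-trans (ψ-cong (toℤ-fromℤ _)) (ψφ (toℤ i)))) (sym (v-toℤ i))

  rotation : ∀ {s} → Even s → Symmetry (induced (_+ s))
  rotation {s} e = symmetry-from-parts id-involutive
                     (induced-inverse (+-congʳ (- s)) back) (induced-inverse (+-congʳ s) forth)
                     (rotation-parts e) (rotation-parts (-even e))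
    where
    back : ∀ x → x + s + - s ≈ x
    back x = ≈-reflexive (lemma x s)
      where lemma : ∀ x s → x + s + - s ≡ x
            lemma = solve-∀
    forth : ∀ x → x + - s + s ≈ x
    forth x = ≈-reflexive (lemma x s)
      where lemma : ∀ x s → x + - s + s ≡ x
            lemma = solve-∀
    rotation-parts : ∀ {t} → Even t → PartsTo (λ P → P) (induced (_+ t))
    rotation-parts {t} et = lift-parts (λ P → P) u[]-cong v[]-cong (+-congʳ t) step jumps (λ y → fwd (fromℤ y))
      where
      commute : ∀ x c → x + c + t ≈ x + t + c
      commute x c = ≈-reflexive (lemma x c t)
        where lemma : ∀ x c t → x + c + t ≡ x + t + c
              lemma = solve-∀
      step : ∀ x → UEdge u[ x + t ] u[ x + + 1 + t ]
      step x = subst (UEdge _) (u[]-cong (≈-sym (commute x (+ 1)))) (u-step (x + t))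
      jumps : ∀ {x} → Even x → VEdge v[ x + t ] v[ x + A + t ] × VEdge v[ x + t ] v[ x + B + t ]
      jumps {x} ex = v-jump (even+even ex et) (inj₁ (commute x A))
                   , v-jump (even+even ex et) (inj₂ (commute x B))

  reflection : ∀ {s} → Odd s → Symmetry (induced (_-_ s))
  reflection {s} o = symmetry-from-parts id-involutive involution involution parts parts
    where
    mirror-cong : ∀ {x y} → x ≈ y → s - x ≈ s - y
    mirror-cong p = +-cong (≈-refl {s}) (-‿cong p)
    involution : ∀ z → induced (_-_ s) (induced (_-_ s) z) ≡ z
    involution = induced-inverse mirror-cong (λ x → ≈-reflexive (lemma s x))
      where lemma : ∀ s x → s - (s - x) ≡ x
            lemma = solve-∀
    step : ∀ x → UEdge u[ s - x ] u[ s - (x + + 1) ]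
    step x = subst (UEdge _) (u[]-cong (≈-reflexive (lemma s x))) (u-step⁻ (s - x))
      where lemma : ∀ s x → s - x - + 1 ≡ s - (x + + 1)
            lemma = solve-∀
    jump : ∀ {x c} → Even x → Odd c →
           (s - x ≈ s - (x + c) + c → s - x ≈ s - (x + c) + A ⊎ s - x ≈ s - (x + c) + B) →
           VEdge v[ s - x ] v[ s - (x + c) ]
    jump {x} {c} ex oc label = VEdge-sym (v-jump (odd-odd o (even+odd ex oc)) (label (≈-reflexive (lemma s x c))))
      where lemma : ∀ s x c → s - x ≡ s - (x + c) + c
            lemma = solve-∀
    parts : PartsTo (λ P → P) (induced (_-_ s))
    parts = lift-parts (λ P → P) u[]-cong v[]-cong mirror-cong step
                       (λ ex → jump ex A-odd inj₁ , jump ex B-odd inj₂) (λ y → fwd (fromℤ y))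

  swap-symmetry : ∀ π κ labels → Swap.Admissible π κ labels → Symmetry (induced-swap (Swap.σ π κ labels))
  swap-symmetry π κ labels admissible = symmetry-from-parts exchange-involutive involution involution parts parts
    where
    open Swap π κ labels
    involution : ∀ z → induced-swap σ (induced-swap σ z) ≡ z
    involution = induced-swap-inverse σ-cong (σ-involutive admissible)
    parts : PartsTo exchange (induced-swap σ)
    parts = lift-parts exchange v[]-cong u[]-cong σ-cong σ-adjacent (σ-jumps admissible) (λ y → bwd (fromℤ y))


module Characterisation (n a b : ℕ) .{{_ : NonZero n}} (4≤n : 4 ≤ n) (n-even : n % 2 ≡ 0)
                        (a-odd : a % 2 ≡ 1) (b-odd : b % 2 ≡ 1) (0<a : 0 < a) (a<b : a < b) (b<n : b < n)
                        (a≢n∸b : a ≢ n ∸ b) where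

  open Graph n a b
  open Congruence n
  open Residues n
  open Parity
  open Edges n n-even a b a-odd b-odd
  open Symmetries n n-even a b a-odd b-odd

  2<n : 2 < n
  2<n = ℕP.<-≤-trans (ℕ.s≤s (ℕ.s≤s (ℕ.s≤s ℕ.z≤n))) 4≤n

  0<n : 0 < n
  0<n = ℕP.<-trans (ℕ.s≤s ℕ.z≤n) 2<n

  A≉B : ¬ A ≈ B
  A≉B p = ℕP.<⇒≢ a<b (residue-injective (ℕP.<-trans a<b b<n) b<n p)

  multiple-below-2n : ∀ {m} → 0 < m → m < n ℕ.+ n → + m ≈ + 0 → m ≡ n
  multiple-below-2n {m} 0<m m<2n m≈0 with ℕP.<-cmp m n
  ... | tri< m<n _ _ = ⊥-elim (ℕP.<⇒≢ 0<m (sym (residue-injective m<n 0<n m≈0)))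
  ... | tri≈ _ m≡n _ = m≡n
  ... | tri> _ _ n<m = ⊥-elim (ℕP.m>n⇒m∸n≢0 n<m (residue-injective (ℕP.m<n+o⇒m∸n<o m n m<2n) 0<n m∸n≈0))
    where
    n≈0 : + n ≈ + 0
    n≈0 = mk (divides (+ 1) (trans (ℤP.+-identityʳ (+ n)) (sym (ℤP.*-identityˡ (+ n)))))
    m∸n≈0 : + (m ∸ n) ≈ + 0
    m∸n≈0 = subst (_≈ + 0) (trans (ℤP.m-n≡m⊖n m n) (ℤP.⊖-≥ (ℕP.<⇒≤ n<m))) (+-cong m≈0 (-‿cong n≈0))

  A+B≉0 : ¬ A + B ≈ + 0
  A+B≉0 p = a≢n∸b (trans (sym (ℕP.m+n∸n≡m a b)) (cong (_∸ b) a+b≡n))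
    where a+b≡n : a ℕ.+ b ≡ n
          a+b≡n = multiple-below-2n (ℕP.<-≤-trans 0<a (ℕP.m≤m+n a b)) (ℕP.+-mono-< (ℕP.<-trans a<b b<n) b<n)
                                    (subst (_≈ + 0) (sym (ℤP.pos-+ a b)) p)

  ¬[2A≈0×2B≈0] : A + A ≈ + 0 → B + B ≈ + 0 → ⊥
  ¬[2A≈0×2B≈0] p q = ℕP.<⇒≢ (ℕP.+-mono-< a<b a<b)
                           (trans (double a (ℕP.<-trans a<b b<n) 0<a p) (sym (double b b<n (ℕP.<-trans 0<a a<b) q)))
    where double : ∀ k → k < n → 0 < k → + k + + k ≈ + 0 → k ℕ.+ k ≡ n
          double k k<n 0<k p = multiple-below-2n (ℕP.<-≤-trans 0<k (ℕP.m≤m+n k k)) (ℕP.+-mono-< k<n k<n)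
                                                 (subst (_≈ + 0) (sym (ℤP.pos-+ k k)) p)

  module Rigidity {k} (K : PartitionInjection k) where

    open PartitionInjection K

    image-of-v : ∀ {r : ℤ → ℤ} → (∀ x → k u[ x ] ≡ u[ r x ]) → ∀ x → k v[ x ] ≡ v[ r x ]
    image-of-v {r} ku x = M-unique (subst (λ z → MEdge z (k v[ x ])) (ku x) (matching-preserved 2<n K (fwd (fromℤ x))))
                                   (fwd (fromℤ (r x)))

    module Preserving (preserves : PartsFollow (λ P → P) k) (c : ℤ) (kc : k u[ c ] ≡ u[ c ]) where

      U-to : ∀ {x y} → UEdge x y → UEdge (k x) (k y)
      U-to = Equivalence.to (preserves partU _ _)

      V-to : ∀ {x y} → VEdge x y → VEdge (k x) (k y)
      V-to = Equivalence.to (preserves partV _ _)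

      identity : k u[ c + + 1 ] ≡ u[ c + + 1 ] → ∀ y → k y ≡ y
      identity next = fixed
        where
        ku : ∀ x → k u[ x ] ≡ u[ x ]
        ku = u-image-follows-path 2<n K U-to u[_] u[]-cong (λ x → Sum.swap ∘ u-neighbours x) c kc next
        fixed : ∀ y → k y ≡ y
        fixed (u i) = trans (cong k (u-toℤ i)) (trans (ku (toℤ i)) (sym (u-toℤ i)))
        fixed (v i) = trans (cong k (v-toℤ i)) (trans (image-of-v {λ x → x} ku (toℤ i)) (sym (v-toℤ i)))

      -- The reflection x ↦ 2c − x would send the V-edges v₀v_a, v₀v_b to V-edges at the even
      -- vertex v_{2c}, forcing a + a or a + b, and b + a or b + b, to vanish modulo n.
      ¬reflection : k u[ c + + 1 ] ≢ u[ c - + 1 ]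
      ¬reflection next =
        Sum.[ (λ 2A≈0 → Sum.[ (λ B+A≈0 → A+B≉0 (subst (_≈ + 0) (ℤP.+-comm B A) B+A≈0))
                             , ¬[2A≈0×2B≈0] 2A≈0 ]′ (jump-image {B} (v-jump even-0 (inj₂ ≈-refl))))
            , A+B≉0 ]′ (jump-image {A} (v-jump even-0 (inj₁ ≈-refl)))
        where
        mirror : ℤ → ℤ
        mirror x = c + c - x
        mirror-cong : ∀ {x y} → x ≈ y → mirror x ≈ mirror y
        mirror-cong p = +-cong (≈-refl {c + c}) (-‿cong p)
        mirror-neighbours : ∀ x {w} → UEdge u[ mirror x ] w → w ≡ u[ mirror (x - + 1) ] ⊎ w ≡ u[ mirror (x + + 1) ]
        mirror-neighbours x e = Sum.map (λ eq → trans eq (u[]-cong (≈-reflexive (lemma₁ c x))))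
                                        (λ eq → trans eq (u[]-cong (≈-reflexive (lemma₂ c x)))) (u-neighbours (mirror x) e)
          where lemma₁ : ∀ c x → c + c - x + + 1 ≡ c + c - (x - + 1)
                lemma₁ = solve-∀
                lemma₂ : ∀ c x → c + c - x - + 1 ≡ c + c - (x + + 1)
                lemma₂ = solve-∀
        ku : ∀ x → k u[ x ] ≡ u[ mirror x ]
        ku = u-image-follows-path 2<n K U-to (λ x → u[ mirror x ]) (u[]-cong ∘ mirror-cong) mirror-neighbours c
               (trans kc (u[]-cong (≈-reflexive (lemma₁ c))))
               (trans next (u[]-cong (≈-reflexive (lemma₂ c))))
          where lemma₁ : ∀ c → c ≡ c + c - c
                lemma₁ = solve-∀
                lemma₂ : ∀ c → c - + 1 ≡ c + c - (c + + 1)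
                lemma₂ = solve-∀
        mirror-0-even : Even (mirror (+ 0))
        mirror-0-even = Congruence.mk (divides c (lemma c))
          where lemma : ∀ c → c + c - + 0 - + 0 ≡ c * + 2
                lemma = solve-∀
        jump-image : ∀ {d} → VEdge v[ + 0 ] v[ + 0 + d ] → d + A ≈ + 0 ⊎ d + B ≈ + 0
        jump-image {d} e =
          Sum.map (landing A) (landing B)
                  (v-neighbours-even mirror-0-even
                     (subst₂ VEdge (image-of-v {mirror} ku (+ 0)) (image-of-v {mirror} ku (+ 0 + d)) (V-to e)))
          where landing : ∀ t → v[ mirror (+ 0 + d) ] ≡ v[ mirror (+ 0) + t ] → d + t ≈ + 0
                landing t eq = subst (_≈ + 0) (lemma c d t)
                                     (≈⇒-≈0 (≈-sym (v[]-injective {mirror (+ 0 + d)} {mirror (+ 0) + t} eq)))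
                  where lemma : ∀ c d t → c + c - + 0 + t - (c + c - (+ 0 + d)) ≡ d + t
                        lemma = solve-∀

      fixes : ∀ y → k y ≡ y
      fixes = Sum.[ identity , ⊥-elim ∘ ¬reflection ]′
                (u-neighbours c (subst (λ z → UEdge z (k u[ c + + 1 ])) kc (U-to (u-step c))))

    fixes-u : ∀ c → k u[ c ] ≡ u[ c ] → ∀ y → k y ≡ y
    fixes-u c kc = Sum.[ (λ preserves → Preserving.fixes preserves c kc)
                       , (λ exchanges → ⊥-elim (no-V-edge-at-u (V-edge exchanges))) ]′ (preserves-or-exchanges 2<n K)
      where
      no-V-edge-at-u : ∀ {i w} → ¬ VEdge (u i) w
      no-V-edge-at-u ()
      V-edge : PartsFollow exchange k → VEdge u[ c ] (k u[ c + + 1 ])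
      V-edge exchanges = subst (λ z → VEdge z (k u[ c + + 1 ])) kc (Equivalence.to (exchanges partU _ _) (u-step c))

    fixes-v : ∀ c → k v[ c ] ≡ v[ c ] → ∀ y → k y ≡ y
    fixes-v c kc = fixes-u c (M-unique (MEdge-sym (subst (MEdge _) kc (matching-preserved 2<n K (fwd (fromℤ c))))) (bwd (fromℤ c)))

    rigid : ∀ x → k x ≡ x → ∀ y → k y ≡ y
    rigid (u i) e = fixes-u (toℤ i) (trans (cong k (sym (u-toℤ i))) (trans e (u-toℤ i)))
    rigid (v i) e = fixes-v (toℤ i) (trans (cong k (sym (v-toℤ i))) (trans e (v-toℤ i)))

  module Forward {g} (G : PartitionInjection g) (g-u₀ : g u[ + 0 ] ≡ v[ + 0 ]) where

    open PartitionInjection G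

    exchanges : PartsFollow exchange g
    exchanges = Sum.[ (λ preserves → ⊥-elim (no-U-edge-at-v (U-edge preserves))) , (λ f → f) ]′
                    (preserves-or-exchanges 2<n G)
      where
      no-U-edge-at-v : ∀ {i w} → ¬ UEdge (v i) w
      no-U-edge-at-v ()
      U-edge : PartsFollow (λ P → P) g → UEdge v[ + 0 ] (g u[ + 0 + + 1 ])
      U-edge preserves = subst (λ z → UEdge z (g u[ + 0 + + 1 ])) g-u₀ (Equivalence.to (preserves partU _ _) (u-step (+ 0)))

    U-to : ∀ {x y} → UEdge x y → VEdge (g x) (g y)
    U-to = Equivalence.to (exchanges partU _ _)

    V-to : ∀ {x y} → VEdge x y → UEdge (g x) (g y)
    V-to = Equivalence.to (exchanges partV _ _)

    M-to : ∀ {x y} → MEdge x y → MEdge (g x) (g y)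
    M-to = Equivalence.to (exchanges partM _ _)

    first-step : g u[ + 0 + + 1 ] ≡ v[ + 0 + A ] ⊎ g u[ + 0 + + 1 ] ≡ v[ + 0 + B ]
    first-step = v-neighbours-even even-0 (subst (λ z → VEdge z (g u[ + 0 + + 1 ])) g-u₀ (U-to (u-step (+ 0))))

    admissible : ∀ π κ labels → g u[ + 0 + + 1 ] ≡ v[ + 0 + Swap.P π κ labels ] → Swap.Admissible π κ labels
    admissible π κ labels g-u₁ =
      Sum.[ (λ adm → adm) , (λ A+B≈0 → ⊥-elim (A+B≉0 A+B≈0)) ]′
            (signs (sign P (edge-to {P} (inj₁ (≈0+ P)))) (sign Q (edge-to {Q} (inj₂ (≈0+ Q)))) σP≉σQ)
      where
      open Swap π κ labels
      ≈0+ : ∀ c → c ≈ + 0 + c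
      ≈0+ c = ≈-reflexive (sym (ℤP.+-identityˡ c))
      σ0≈0 : σ (+ 0) ≈ + 0
      σ0≈0 = ≈-reflexive (trans (σ-even even-0) (ℤP.*-zeroʳ (- δ)))
      g-u : ∀ x → g u[ x ] ≡ v[ σ x ]
      g-u = u-image-follows-path 2<n G U-to (λ x → v[ σ x ]) (v[]-cong ∘ σ-cong) σ-neighbours (+ 0)
              (trans g-u₀ (v[]-cong (≈-sym σ0≈0)))
              (trans g-u₁ (v[]-cong (≈-sym (≈-trans (≈-reflexive (σ-suc-even even-0)) (+-congʳ P σ0≈0)))))
      g-v : ∀ x → g v[ x ] ≡ u[ σ x ]
      g-v x = M-unique (subst (λ z → MEdge z (g v[ x ])) (g-u x) (M-to (fwd (fromℤ x)))) (bwd (fromℤ (σ x)))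
      edge-to : ∀ {c} → c ≈ + 0 + P ⊎ c ≈ + 0 + Q → VEdge v[ + 0 ] v[ c ]
      edge-to {c} p = v-jump even-0 (from-labels {+ 0} {c} p)
      sign : ∀ c → VEdge v[ + 0 ] v[ c ] → σ c ≈ + 1 ⊎ σ c ≈ - + 1
      sign c e = Sum.map (λ eq → ≈-trans (u[]-injective {σ c} {σ (+ 0) + + 1} eq) (+-congʳ (+ 1) σ0≈0))
                         (λ eq → ≈-trans (u[]-injective {σ c} {σ (+ 0) - + 1} eq) (+-congʳ (- + 1) σ0≈0))
                         (u-neighbours (σ (+ 0)) (subst₂ UEdge (g-v (+ 0)) (g-v c) (V-to e)))
      P≉Q : ¬ P ≈ Q
      P≉Q = Sum.[ (λ (P≡A , Q≡B) p → A≉B (subst₂ _≈_ P≡A Q≡B p))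
                , (λ (P≡B , Q≡A) p → A≉B (≈-sym (subst₂ _≈_ P≡B Q≡A p))) ]′ labels
      σP≉σQ : ¬ σ P ≈ σ Q
      σP≉σQ p = P≉Q (v[]-injective {P} {Q} (injective (trans (g-v P) (trans (u[]-cong p) (sym (g-v Q))))))

  α β : ℤ
  α = proj₁ (odd⇒2k+1 A-odd)
  β = proj₁ (odd⇒2k+1 B-odd)

  α-labels : Labelling (α * + 2 + + 1) (β * + 2 + + 1)
  α-labels = inj₁ (proj₂ (odd⇒2k+1 A-odd) , proj₂ (odd⇒2k+1 B-odd))

  β-labels : Labelling (β * + 2 + + 1) (α * + 2 + + 1)
  β-labels = inj₂ (proj₂ (odd⇒2k+1 B-odd) , proj₂ (odd⇒2k+1 A-odd))

  Admissible : Set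
  Admissible = Swap.Admissible α β α-labels ⊎ Swap.Admissible β α β-labels

  forward : HasRegularPartitionPreservingSubgroup → Admissible
  forward (G , group , _ , partition , transitive , _) =
    Sum.map (admissible α β α-labels ∘ relabel (proj₂ (odd⇒2k+1 A-odd)))
            (admissible β α β-labels ∘ relabel (proj₂ (odd⇒2k+1 B-odd))) first-step
    where
    g : Vert → Vert
    g = proj₁ (transitive u[ + 0 ] v[ + 0 ])
    g∈G : G g
    g∈G = proj₁ (proj₂ (transitive u[ + 0 ] v[ + 0 ]))
    g-injective : ∀ {x y} → g x ≡ g y → x ≡ y
    g-injective {x} {y} eq = trans (sym (hg x)) (trans (cong h eq) (hg y))
      where
      h : Vert → Vert
      h = proj₁ (IsPermGroup.has-inv group g∈G)
      hg : ∀ x → h (g x) ≡ x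
      hg = proj₁ (proj₂ (proj₂ (IsPermGroup.has-inv group g∈G)))
    g-partition-injection : PartitionInjection g
    g-partition-injection = record { injective = g-injective ; preserves-partition = partition g∈G }
    open Forward g-partition-injection (proj₂ (proj₂ (transitive u[ + 0 ] v[ + 0 ])))
    relabel : ∀ {c d} → c ≡ d → g u[ + 0 + + 1 ] ≡ v[ + 0 + d ] → g u[ + 0 + + 1 ] ≡ v[ + 0 + c ]
    relabel c≡d eq = trans eq (cong (λ z → v[ + 0 + z ]) (sym c≡d))

  module Backward (π κ : ℤ) (labels : Labelling (π * + 2 + + 1) (κ * + 2 + + 1))
                  (admissible : Swap.Admissible π κ labels) where

    open Swap π κ labels

    Orbit : Vert → Set
    Orbit y = Σ (Vert → Vert) λ g → Symmetry g × g u[ + 0 ] ≡ y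

    reach-u : ∀ c → Orbit u[ c ]
    reach-u c = Sum.[ (λ e → induced (_+ c) , rotation e , u[]-cong rotated)
                    , (λ o → induced (_-_ c) , reflection o , u[]-cong reflected) ]′ (even⊎odd c)
      where
      rotated : toℤ (fromℤ (+ 0)) + c ≈ c
      rotated = ≈-trans (+-congʳ c (toℤ-fromℤ (+ 0))) (≈-reflexive (ℤP.+-identityˡ c))
      reflected : c - toℤ (fromℤ (+ 0)) ≈ c
      reflected = ≈-trans (+-cong (≈-refl {c}) (-‿cong (toℤ-fromℤ (+ 0)))) (≈-reflexive (ℤP.+-identityʳ c))

    swapped : ∀ c → Orbit u[ σ c ] → Orbit v[ c ]
    swapped c (f , F , f-u₀) = induced-swap σ ∘ f , symmetry-∘ (swap-symmetry π κ labels admissible) F ,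
      trans (cong (induced-swap σ) f-u₀) (v[]-cong (≈-trans (σ-cong (toℤ-fromℤ (σ c))) (σ-involutive admissible c)))

    reach : ∀ y → Orbit y
    reach (u i) = subst Orbit (sym (u-toℤ i)) (reach-u (toℤ i))
    reach (v i) = subst Orbit (sym (v-toℤ i)) (swapped (toℤ i) (reach-u (σ (toℤ i))))

    connect : ∀ {x y} → Orbit x → Orbit y → Σ (Vert → Vert) λ g → Symmetry g × g x ≡ y
    connect (f , F , f-u₀) (g , G , g-u₀) = g ∘ Symmetry.inverse F , symmetry-∘ G (symmetry-inverse F) ,
      trans (cong (g ∘ Symmetry.inverse F) (sym f-u₀)) (trans (cong g (Symmetry.inverseˡ F _)) g-u₀)

    semiregular : ∀ {f g} → Symmetry f → Symmetry g → ∀ x → f x ≡ g x → f ≗ g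
    semiregular {f} {g} F G x fx≡gx y = trans (sym (Symmetry.inverseʳ G (f y))) (cong g (fixed y))
      where
      fixed : ∀ y → Symmetry.inverse G (f y) ≡ y
      fixed = Rigidity.rigid (symmetry⇒partition-injection (symmetry-∘ (symmetry-inverse G) F)) x
                (trans (cong (Symmetry.inverse G) fx≡gx) (Symmetry.inverseˡ G x))

    regular-subgroup : HasRegularPartitionPreservingSubgroup
    regular-subgroup = Symmetry , symmetries-form-group , proj₁ ∘ Symmetry.aut , proj₂ ∘ Symmetry.aut
                     , (λ x y → connect (reach x) (reach y)) , semiregular

  backward : Admissible → HasRegularPartitionPreservingSubgroup
  backward = Sum.[ Backward.regular-subgroup α β α-labels , Backward.regular-subgroup β α β-labels ]′

  X₁ X₂ X₃ : ℤ
  X₁ = ((B - A) * (B - A)) ℤ./ + 2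
  X₂ = A + ((A - + 1) * (A - B)) ℤ./ + 2
  X₃ = B + ((B - + 1) * (B - A)) ℤ./ + 2

  Conditions : Set
  Conditions = X₁ ≈ + 2 × (X₂ ≈ + 1 ⊎ X₃ ≈ + 1)

  conditions⇔admissible : Conditions ⇔ Admissible
  conditions⇔admissible = mk⇔ to from
    where
    module α = Swap α β α-labels
    module β = Swap β α β-labels
    X₂≡Kα : X₂ ≡ α.K
    X₂≡Kα = subst₂ (λ x y → x + ((x - + 1) * (x - y)) ℤ./ + 2 ≡ α.K)
                   (proj₂ (odd⇒2k+1 A-odd)) (proj₂ (odd⇒2k+1 B-odd)) α.P-correction≡K
    X₃≡Kβ : X₃ ≡ β.K
    X₃≡Kβ = subst₂ (λ x y → x + ((x - + 1) * (x - y)) ℤ./ + 2 ≡ β.K)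
                   (proj₂ (odd⇒2k+1 B-odd)) (proj₂ (odd⇒2k+1 A-odd)) β.P-correction≡K
    to : Conditions → Admissible
    to (x₁ , inj₁ x₂) = inj₁ (subst (_≈ + 2) α.halved-square≡2δ² x₁ , subst (_≈ + 1) X₂≡Kα x₂)
    to (x₁ , inj₂ x₃) = inj₂ (subst (_≈ + 2) β.halved-square≡2δ² x₁ , subst (_≈ + 1) X₃≡Kβ x₃)
    from : Admissible → Conditions
    from (inj₁ (x₁ , x₂)) = subst (_≈ + 2) (sym α.halved-square≡2δ²) x₁
                          , inj₁ (subst (_≈ + 1) (sym X₂≡Kα) x₂)
    from (inj₂ (x₁ , x₃)) = subst (_≈ + 2) (sym β.halved-square≡2δ²) x₁
                          , inj₂ (subst (_≈ + 1) (sym X₃≡Kβ) x₃)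

  characterisation : HasRegularPartitionPreservingSubgroup ⇔ Conditions
  characterisation = ⇔.trans (mk⇔ forward backward) (⇔.sym conditions⇔admissible)

theorem4p3 : (n a b : ℕ) → .{{_ : NonZero n}} →
    4 ≤ n → n % 2 ≡ 0 → a % 2 ≡ 1 → b % 2 ≡ 1 → 0 < a → a < b → b < n →
    gcd (b ∸ a) n ≡ 2 → a ≢ n ∸ b →
    Graph.HasRegularPartitionPreservingSubgroup n a b
      ⇔ (((((+ b) ℤ.- (+ a)) ℤ.* ((+ b) ℤ.- (+ a))) ℤ./ (+ 2)) ≡ (+ 2) [modℤ n ]
         × (((+ a) ℤ.+ (((+ a) ℤ.- (+ 1)) ℤ.* ((+ a) ℤ.- (+ b))) ℤ./ (+ 2)) ≡ (+ 1) [modℤ n ]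
            ⊎ ((+ b) ℤ.+ (((+ b) ℤ.- (+ 1)) ℤ.* ((+ b) ℤ.- (+ a))) ℤ./ (+ 2)) ≡ (+ 1) [modℤ n ]))
theorem4p3 n a b 4≤n n-even a-odd b-odd 0<a a<b b<n _ a≢n∸b =
  ⇔.trans characterisation (≈⇔≡[modℤ] ×-⇔ (≈⇔≡[modℤ] ⊎-⇔ ≈⇔≡[modℤ]))
  where
  open Characterisation n a b 4≤n n-even a-odd b-odd 0<a a<b b<n a≢n∸b
  open Congruence n using (≈⇔≡[modℤ])
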